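{- For every Young diagram $\lambda$, $$\prod_{u\in\lambda} a(u) \;\le\; \prod_{u\in\lambda} a^\ast(u).$$
   Context: Let $\lambda=(\lambda_1\ge\dots\ge\lambda_\ell>0)$ be an integer partition. Its Young diagram is the set of squares $(i,j)$ with $1\le i\le\ell$, $1\le j\le \lambda_i$. For $(i,j)\in\lambda$, the area number is $a(i,j)=\bigl|\{(p,q)\in\lambda : i\le p,\ j\le q\}\bigr|$ and the anti-area number is $a^\ast(i,j)=i\cdot j$. -}

module Defs where

open import Data.Nat using (ℕ; zero; suc; _+_; _*_; _∸_; _≤_; _≥_)
open import Data.Nat.ListAction using (sum; product)
open import Data.List using (List; []; _∷_; map; drop; _++_; concatMap; length)
open import Data.List.Relation.Unary.All using (All)
open import Data.List.Relation.Unary.Linked using (Linked)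
open import Data.Product using (_×_; _,_)

IsPartition : List ℕ → Set
IsPartition λs = Linked _≥_ λs × All (1 ≤_) λs

range1 : ℕ → List ℕ
range1 zero    = []
range1 (suc n) = range1 n ++ (suc n ∷ [])

-- λ_i (1-indexed); 0 outside the partition.
part : List ℕ → ℕ → ℕ
part []       _             = 0
part (x ∷ xs) zero          = 0
part (x ∷ xs) (suc zero)    = x
part (x ∷ xs) (suc (suc i)) = part xs (suc i)

cells : List ℕ → List (ℕ × ℕ)
cells λs = concatMap (λ i → map (λ j → (i , j)) (range1 (part λs i))) (range1 (length λs))

-- Area number a(i,j) = |{(p,q) ∈ λ : i ≤ p, j ≤ q}|
--   = Σ_{p = i}^{ℓ} |{q : j ≤ q ≤ λ_p}| = Σ_{p ≥ i} (λ_p ∸ (j ∸ 1)).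
area : List ℕ → ℕ × ℕ → ℕ
area λs (i , j) = sum (map (λ λp → λp ∸ (j ∸ 1)) (drop (i ∸ 1) λs))

antiArea : ℕ × ℕ → ℕ
antiArea (i , j) = i * j

{-# OPTIONS --safe #-}
-- Let λ⁻ = (λ₁ − 1, λ₂ − 1, …) be λ with its first column removed. The area numbers of the
-- remaining cells of λ are exactly those of λ⁻, so ∏ a over λ is ∏ᵢ a(i,1) times ∏ a over λ⁻.
-- On the anti-area side remove instead the last cell of every row: its anti-area number is i·λᵢ,
-- and what is left is the diagram of λ⁻ with unchanged anti-area numbers. By induction on λ₁
-- it therefore suffices that ∏ᵢ a(i,1) ≤ ∏ᵢ i·λᵢ, which holds because
-- a(i,1) = λᵢ + … + λ_ℓ ≤ (ℓ − i + 1)·λᵢ and both ∏ᵢ (ℓ − i + 1)·λᵢ and ∏ᵢ i·λᵢ equal ℓ!·∏ᵢ λᵢ.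
--
-- Since λ⁻ may have parts 0, everything below is stated for weakly decreasing lists of naturals,
-- an empty row contributing the factor 1.
module Submission where

open import Defs
open import Data.Nat using (ℕ; _≤_)
open import Data.List using (List; map)
open import Data.Nat.ListAction using (product)

open import Data.Nat using (zero; suc; _+_; _*_; _∸_; _≥_; pred; _!; z≤n)
open import Data.Nat.ListAction using (sum)
open import Data.Nat.ListAction.Properties using (product-++)
open import Data.Nat.Properties
open import Algebra.Properties.CommutativeSemigroup *-commutativeSemigroup
  using (interchange; x∙yz≈y∙xz; xy∙z≈y∙xz)
open import Data.List using ([]; _∷_; _++_; concatMap; drop; length)
open import Data.List.Properties using (map-++; map-∘; map-id; map-cong; drop-map)
open import Data.List.Relation.Unary.All using (All; []; _∷_)
open import Data.List.Relation.Unary.Linked using (Linked)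
import Data.List.Relation.Unary.Linked as Linked
import Data.List.Relation.Unary.Linked.Properties as Linked
open import Data.Product using (_×_; _,_; map₁; map₂)
open import Function using (_∘_)
open import Relation.Binary.PropositionalEquality

∏[1‥_]_ : ℕ → (ℕ → ℕ) → ℕ
∏[1‥ n ] f = product (map f (range1 n))

range1-suc : ∀ n → range1 (suc n) ≡ 1 ∷ map suc (range1 n)
range1-suc zero    = refl
range1-suc (suc n) = begin
  range1 (suc n) ++ suc (suc n) ∷ []          ≡⟨ cong (_++ suc (suc n) ∷ []) (range1-suc n) ⟩
  1 ∷ map suc (range1 n) ++ suc (suc n) ∷ []  ≡⟨ cong (1 ∷_) (map-++ suc (range1 n) _) ⟨
  1 ∷ map suc (range1 (suc n))                ∎
  where open ≡-Reasoning

∏-peel-first : ∀ f n → ∏[1‥ suc n ] f ≡ f 1 * ∏[1‥ n ] (f ∘ suc)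
∏-peel-first f n = begin
  product (map f (range1 (suc n)))            ≡⟨ cong (product ∘ map f) (range1-suc n) ⟩
  f 1 * product (map f (map suc (range1 n)))  ≡⟨ cong ((f 1 *_) ∘ product) (map-∘ (range1 n)) ⟨
  f 1 * ∏[1‥ n ] (f ∘ suc)                    ∎
  where open ≡-Reasoning

∏-peel-last : ∀ f n → ∏[1‥ suc n ] f ≡ ∏[1‥ n ] f * f (suc n)
∏-peel-last f n = begin
  product (map f (range1 n ++ suc n ∷ []))      ≡⟨ cong product (map-++ f (range1 n) _) ⟩
  product (map f (range1 n) ++ f (suc n) ∷ [])  ≡⟨ product-++ (map f (range1 n)) _ ⟩
  ∏[1‥ n ] f * (f (suc n) * 1)                  ≡⟨ cong (∏[1‥ n ] f *_) (*-identityʳ (f (suc n))) ⟩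
  ∏[1‥ n ] f * f (suc n)                        ∎
  where open ≡-Reasoning

∏-cong : ∀ {f g} → (∀ j → f (suc j) ≡ g (suc j)) → ∀ n → ∏[1‥ n ] f ≡ ∏[1‥ n ] g
∏-cong             f≗g zero    = refl
∏-cong {f} {g} f≗g (suc n) = begin
  ∏[1‥ suc n ] f         ≡⟨ ∏-peel-last f n ⟩
  ∏[1‥ n ] f * f (suc n) ≡⟨ cong₂ _*_ (∏-cong f≗g n) (f≗g n) ⟩
  ∏[1‥ n ] g * g (suc n) ≡⟨ ∏-peel-last g n ⟨
  ∏[1‥ suc n ] g         ∎
  where open ≡-Reasoning

whenNonzero : ℕ → ℕ → ℕ
whenNonzero zero    _ = 1
whenNonzero (suc _) a = a

∏-first-factor : ∀ f m → ∏[1‥ m ] f ≡ whenNonzero m (f 1) * ∏[1‥ pred m ] (f ∘ suc)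
∏-first-factor f zero    = refl
∏-first-factor f (suc n) = ∏-peel-first f n

∏-last-factor : ∀ f m → ∏[1‥ m ] f ≡ whenNonzero m (f m) * ∏[1‥ pred m ] f
∏-last-factor f zero    = refl
∏-last-factor f (suc n) = trans (∏-peel-last f n) (*-comm (∏[1‥ n ] f) (f (suc n)))

rowsProduct : (ℕ → ℕ → ℕ) → List ℕ → ℕ
rowsProduct g []       = 1
rowsProduct g (x ∷ xs) = g 1 x * rowsProduct (g ∘ suc) xs

rowsProduct-cong : ∀ {g h} → (∀ i m → g (suc i) m ≡ h (suc i) m) →
                   ∀ L → rowsProduct g L ≡ rowsProduct h L
rowsProduct-cong g≗h []       = refl
rowsProduct-cong g≗h (x ∷ xs) = cong₂ _*_ (g≗h 0 x) (rowsProduct-cong (g≗h ∘ suc) xs)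

rowsProduct-map : ∀ g f L → rowsProduct g (map f L) ≡ rowsProduct (λ i m → g i (f m)) L
rowsProduct-map g f []       = refl
rowsProduct-map g f (x ∷ xs) = cong (g 1 (f x) *_) (rowsProduct-map (g ∘ suc) f xs)

rowsProduct-distrib-* : ∀ g h L →
  rowsProduct (λ i m → g i m * h i m) L ≡ rowsProduct g L * rowsProduct h L
rowsProduct-distrib-* g h []       = refl
rowsProduct-distrib-* g h (x ∷ xs) = begin
  (g 1 x * h 1 x) * rowsProduct (λ i m → g (suc i) m * h (suc i) m) xs
    ≡⟨ cong ((g 1 x * h 1 x) *_) (rowsProduct-distrib-* (g ∘ suc) (h ∘ suc) xs) ⟩
  (g 1 x * h 1 x) * (rowsProduct (g ∘ suc) xs * rowsProduct (h ∘ suc) xs)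
    ≡⟨ interchange (g 1 x) (h 1 x) _ _ ⟩
  (g 1 x * rowsProduct (g ∘ suc) xs) * (h 1 x * rowsProduct (h ∘ suc) xs) ∎
  where open ≡-Reasoning

grid : (ℕ × ℕ → ℕ) → List ℕ → ℕ
grid F = rowsProduct (λ i m → ∏[1‥ m ] (λ j → F (i , j)))

grid-cong : ∀ {F G} → (∀ i j → F (suc i , suc j) ≡ G (suc i , suc j)) →
            ∀ L → grid F L ≡ grid G L
grid-cong F≗G = rowsProduct-cong (λ i m → ∏-cong (F≗G i) m)

∏-rows : ∀ h L → ∏[1‥ length L ] (λ i → h i (part L i)) ≡ rowsProduct h L
∏-rows h []       = refl
∏-rows h (x ∷ xs) = begin
  ∏[1‥ suc (length xs) ] (λ i → h i (part (x ∷ xs) i))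
    ≡⟨ ∏-peel-first _ (length xs) ⟩
  h 1 x * ∏[1‥ length xs ] (λ i → h (suc i) (part (x ∷ xs) (suc i)))
    ≡⟨ cong (h 1 x *_) (∏-cong (λ _ → refl) (length xs)) ⟩
  h 1 x * ∏[1‥ length xs ] (λ i → h (suc i) (part xs i))
    ≡⟨ cong (h 1 x *_) (∏-rows (h ∘ suc) xs) ⟩
  h 1 x * rowsProduct (h ∘ suc) xs ∎
  where open ≡-Reasoning

product-concatMap : ∀ {A B : Set} (F : B → ℕ) (G : A → List B) xs →
  product (map F (concatMap G xs)) ≡ product (map (λ x → product (map F (G x))) xs)
product-concatMap F G []       = refl
product-concatMap F G (x ∷ xs) = begin
  product (map F (G x ++ concatMap G xs))
    ≡⟨ cong product (map-++ F (G x) (concatMap G xs)) ⟩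
  product (map F (G x) ++ map F (concatMap G xs))
    ≡⟨ product-++ (map F (G x)) _ ⟩
  product (map F (G x)) * product (map F (concatMap G xs))
    ≡⟨ cong (product (map F (G x)) *_) (product-concatMap F G xs) ⟩
  product (map F (G x)) * product (map (λ x → product (map F (G x))) xs) ∎
  where open ≡-Reasoning

product-cells : ∀ F L → product (map F (cells L)) ≡ grid F L
product-cells F L = begin
  product (map F (concatMap row (range1 (length L))))
    ≡⟨ product-concatMap F row (range1 (length L)) ⟩
  ∏[1‥ length L ] (λ i → product (map F (row i)))
    ≡⟨ ∏-cong (λ i → cong product (sym (map-∘ (range1 (part L (suc i)))))) (length L) ⟩
  ∏[1‥ length L ] (λ i → ∏[1‥ part L i ] (λ j → F (i , j)))
    ≡⟨ ∏-rows (λ i m → ∏[1‥ m ] (λ j → F (i , j))) L ⟩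
  grid F L ∎
  where
  open ≡-Reasoning
  row : ℕ → List (ℕ × ℕ)
  row i = map (i ,_) (range1 (part L i))

firstColumn : (ℕ × ℕ → ℕ) → List ℕ → ℕ
firstColumn F = rowsProduct (λ i m → whenNonzero m (F (i , 1)))

lastCells : (ℕ × ℕ → ℕ) → List ℕ → ℕ
lastCells F = rowsProduct (λ i m → whenNonzero m (F (i , m)))

grid-peel-firstColumn : ∀ F L → grid F L ≡ firstColumn F L * grid (F ∘ map₂ suc) (map pred L)
grid-peel-firstColumn F L = begin
  grid F L
    ≡⟨ rowsProduct-cong (λ i m → ∏-first-factor (λ j → F (suc i , j)) m) L ⟩
  rowsProduct (λ i m → whenNonzero m (F (i , 1)) * ∏[1‥ pred m ] (λ j → F (i , suc j))) L
    ≡⟨ rowsProduct-distrib-* _ _ L ⟩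
  firstColumn F L * rowsProduct (λ i m → ∏[1‥ pred m ] (λ j → F (i , suc j))) L
    ≡⟨ cong (firstColumn F L *_) (rowsProduct-map _ pred L) ⟨
  firstColumn F L * grid (F ∘ map₂ suc) (map pred L) ∎
  where open ≡-Reasoning

grid-peel-lastCells : ∀ F L → grid F L ≡ lastCells F L * grid F (map pred L)
grid-peel-lastCells F L = begin
  grid F L
    ≡⟨ rowsProduct-cong (λ i m → ∏-last-factor (λ j → F (suc i , j)) m) L ⟩
  rowsProduct (λ i m → whenNonzero m (F (i , m)) * ∏[1‥ pred m ] (λ j → F (i , j))) L
    ≡⟨ rowsProduct-distrib-* _ _ L ⟩
  lastCells F L * rowsProduct (λ i m → ∏[1‥ pred m ] (λ j → F (i , j))) L
    ≡⟨ cong (lastCells F L *_) (rowsProduct-map _ pred L) ⟨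
  lastCells F L * grid F (map pred L) ∎
  where open ≡-Reasoning

∸-suc : ∀ m n → m ∸ suc n ≡ pred m ∸ n
∸-suc zero    n = sym (0∸n≡0 n)
∸-suc (suc m) n = refl

area-map-pred : ∀ L i j → area L (i , suc (suc j)) ≡ area (map pred L) (i , suc j)
area-map-pred L i j = begin
  sum (map (_∸ suc j) (drop (i ∸ 1) L))
    ≡⟨ cong sum (map-cong (λ m → ∸-suc m j) (drop (i ∸ 1) L)) ⟩
  sum (map ((_∸ j) ∘ pred) (drop (i ∸ 1) L))
    ≡⟨ cong sum (map-∘ (drop (i ∸ 1) L)) ⟩
  sum (map (_∸ j) (map pred (drop (i ∸ 1) L)))
    ≡⟨ cong (sum ∘ map (_∸ j)) (drop-map (i ∸ 1) L) ⟨
  sum (map (_∸ j) (drop (i ∸ 1) (map pred L))) ∎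
  where open ≡-Reasoning

nonzeroCount : List ℕ → ℕ
nonzeroCount []           = 0
nonzeroCount (zero  ∷ xs) = nonzeroCount xs
nonzeroCount (suc _ ∷ xs) = suc (nonzeroCount xs)

nonzeroProduct : List ℕ → ℕ
nonzeroProduct = rowsProduct (λ _ m → whenNonzero m m)

head-≥-all : ∀ {x xs} → Linked _≥_ (x ∷ xs) → All (_≤ x) (x ∷ xs)
head-≥-all = Linked.Linked⇒All (λ x≥y y≥z → ≤-trans y≥z x≥y) ≤-refl

sum≤nonzeroCount* : ∀ {h} L → All (_≤ h) L → sum L ≤ nonzeroCount L * h
sum≤nonzeroCount* []           []       = z≤n
sum≤nonzeroCount* (zero  ∷ xs) (_ ∷ ps) = sum≤nonzeroCount* xs ps
sum≤nonzeroCount* (suc _ ∷ xs) (p ∷ ps) = +-mono-≤ p (sum≤nonzeroCount* xs ps)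

firstColumn-area-∷ : ∀ x xs →
  firstColumn (area (x ∷ xs)) (x ∷ xs) ≡ whenNonzero x (sum (x ∷ xs)) * firstColumn (area xs) xs
firstColumn-area-∷ x xs =
  cong₂ _*_ (cong (whenNonzero x ∘ sum) (map-id (x ∷ xs))) (rowsProduct-cong (λ _ _ → refl) xs)

firstColumn-area≤ : ∀ L → Linked _≥_ L →
                    firstColumn (area L) L ≤ nonzeroCount L ! * nonzeroProduct L
firstColumn-area≤ []           _  = ≤-refl
firstColumn-area≤ (zero ∷ xs)  lk = begin
  firstColumn (area (0 ∷ xs)) (0 ∷ xs)
    ≡⟨ firstColumn-area-∷ 0 xs ⟩
  1 * firstColumn (area xs) xs
    ≤⟨ *-monoʳ-≤ 1 (firstColumn-area≤ xs (Linked.tail lk)) ⟩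
  1 * (nonzeroCount xs ! * nonzeroProduct xs)
    ≡⟨ x∙yz≈y∙xz 1 (nonzeroCount xs !) (nonzeroProduct xs) ⟩
  nonzeroCount xs ! * (1 * nonzeroProduct xs) ∎
  where open ≤-Reasoning
firstColumn-area≤ (suc m ∷ xs) lk = begin
  firstColumn (area L) L
    ≡⟨ firstColumn-area-∷ (suc m) xs ⟩
  sum L * firstColumn (area xs) xs
    ≤⟨ *-mono-≤ (sum≤nonzeroCount* L (head-≥-all lk)) (firstColumn-area≤ xs (Linked.tail lk)) ⟩
  (suc k * suc m) * (k ! * nonzeroProduct xs)
    ≡⟨ interchange (suc k) (suc m) (k !) (nonzeroProduct xs) ⟩
  (suc k * k !) * (suc m * nonzeroProduct xs) ∎
  where
  open ≤-Reasoning
  L = suc m ∷ xs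
  k = nonzeroCount xs

-- Empty rows are skipped without being counted, so the induction only keeps the lower bound
-- i + r on the weight of row i, not its exact value.
!≤rowsProduct : ∀ r g L → (∀ i → suc i + r ≤ g (suc i)) →
  (r + nonzeroCount L) ! ≤ r ! * rowsProduct (λ i m → whenNonzero m (g i)) L
!≤rowsProduct r g [] _ = ≤-reflexive (trans (cong _! (+-identityʳ r)) (sym (*-identityʳ (r !))))
!≤rowsProduct r g (zero ∷ xs) g≥ = begin
  (r + nonzeroCount xs) !
    ≤⟨ !≤rowsProduct r (g ∘ suc) xs (λ i → ≤-trans (n≤1+n _) (g≥ (suc i))) ⟩
  r ! * R
    ≡⟨ cong (r ! *_) (*-identityˡ R) ⟨
  r ! * (1 * R) ∎
  where
  open ≤-Reasoning
  R = rowsProduct (λ i m → whenNonzero m (g (suc i))) xs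
!≤rowsProduct r g (suc _ ∷ xs) g≥ = begin
  (r + suc k) !
    ≡⟨ cong _! (+-suc r k) ⟩
  (suc r + k) !
    ≤⟨ !≤rowsProduct (suc r) (g ∘ suc) xs g∘suc≥ ⟩
  (suc r * r !) * R
    ≤⟨ *-monoˡ-≤ R (*-monoˡ-≤ (r !) (g≥ 0)) ⟩
  (g 1 * r !) * R
    ≡⟨ xy∙z≈y∙xz (g 1) (r !) R ⟩
  r ! * (g 1 * R) ∎
  where
  open ≤-Reasoning
  k = nonzeroCount xs
  R = rowsProduct (λ i m → whenNonzero m (g (suc i))) xs
  g∘suc≥ : ∀ i → suc i + suc r ≤ g (suc (suc i))
  g∘suc≥ i = subst (_≤ g (suc (suc i))) (sym (+-suc (suc i) r)) (g≥ (suc i))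

whenNonzero-* : ∀ m a b → whenNonzero m (a * b) ≡ whenNonzero m a * whenNonzero m b
whenNonzero-* zero    a b = refl
whenNonzero-* (suc _) a b = refl

lastCells-antiArea : ∀ L →
  lastCells antiArea L ≡ rowsProduct (λ i m → whenNonzero m i) L * nonzeroProduct L
lastCells-antiArea L =
  trans (rowsProduct-cong (λ i m → whenNonzero-* m (suc i) m) L) (rowsProduct-distrib-* _ _ L)

firstColumn-area≤lastCells-antiArea : ∀ L → Linked _≥_ L →
                                      firstColumn (area L) L ≤ lastCells antiArea L
firstColumn-area≤lastCells-antiArea L lk = begin
  firstColumn (area L) L
    ≤⟨ firstColumn-area≤ L lk ⟩
  nonzeroCount L ! * nonzeroProduct L
    ≤⟨ *-monoˡ-≤ (nonzeroProduct L) (!≤rowsProduct 0 (λ i → i) L (≤-reflexive ∘ +-identityʳ ∘ suc)) ⟩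
  1 * rowIndices * nonzeroProduct L
    ≡⟨ cong (_* nonzeroProduct L) (*-identityˡ rowIndices) ⟩
  rowIndices * nonzeroProduct L
    ≡⟨ lastCells-antiArea L ⟨
  lastCells antiArea L ∎
  where
  open ≤-Reasoning
  rowIndices = rowsProduct (λ i m → whenNonzero m i) L

grid-zeros : ∀ F L → All (_≤ 0) L → grid F L ≡ 1
grid-zeros F []       []          = refl
grid-zeros F (0 ∷ xs) (z≤n ∷ ps) =
  trans (*-identityˡ _) (grid-zeros (F ∘ map₁ suc) xs ps)

grid-area≤grid-antiArea : ∀ x xs → Linked _≥_ (x ∷ xs) →
  grid (area (x ∷ xs)) (x ∷ xs) ≤ grid antiArea (x ∷ xs)
grid-area≤grid-antiArea zero xs lk =
  ≤-reflexive (trans (grid-zeros (area (0 ∷ xs)) _ zeros) (sym (grid-zeros antiArea _ zeros)))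
  where zeros = head-≥-all lk
grid-area≤grid-antiArea (suc n) xs lk = begin
  grid (area L) L
    ≡⟨ grid-peel-firstColumn (area L) L ⟩
  firstColumn (area L) L * grid (area L ∘ map₂ suc) L′
    ≡⟨ cong (firstColumn (area L) L *_) (grid-cong {area L ∘ map₂ suc} {area L′} shifted L′) ⟩
  firstColumn (area L) L * grid (area L′) L′
    ≤⟨ *-mono-≤ (firstColumn-area≤lastCells-antiArea L lk)
                (grid-area≤grid-antiArea n (map pred xs) (Linked.map⁺ (Linked.map pred-mono-≤ lk))) ⟩
  lastCells antiArea L * grid antiArea L′
    ≡⟨ grid-peel-lastCells antiArea L ⟨
  grid antiArea L ∎
  where
  open ≤-Reasoning
  L  = suc n ∷ xs
  L′ = map pred L
  shifted : ∀ i j → area L (suc i , suc (suc j)) ≡ area L′ (suc i , suc j)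
  shifted i = area-map-pred L (suc i)

corollary1p5 : (λs : List ℕ) → IsPartition λs →
    product (map (area λs) (cells λs)) ≤ product (map antiArea (cells λs))
corollary1p5 []       _        = ≤-refl
corollary1p5 (x ∷ xs) (lk , _) = begin
  product (map (area L) (cells L)) ≡⟨ product-cells (area L) L ⟩
  grid (area L) L                  ≤⟨ grid-area≤grid-antiArea x xs lk ⟩
  grid antiArea L                  ≡⟨ product-cells antiArea L ⟨
  product (map antiArea (cells L)) ∎
  where
  open ≤-Reasoning
  L = x ∷ xs
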